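{- The axiomatization consisting of A1-4, T1$'$, T2 and WE is sound and ground-complete for BCCS($A$) modulo $\precsim_{\rm WT}$. If $|A|>1$, this axiomatization is also $\omega$-complete.
   Context: $A$ is a nonempty countable set of actions, $\tau\notin A$, $A_\tau=A\cup\{\tau\}$. BCCS($A$) terms: $t::=0\mid x\mid\alpha t\mid t+t$ ($x$ a variable, $\alpha\in A_\tau$). Transitions: $\alpha t\xrightarrow{\alpha}t$; if $t\xrightarrow{\alpha}t'$ then $t+u\xrightarrow{\alpha}t'$ and $u+t\xrightarrow{\alpha}t'$. $\Rightarrow$ is the reflexive-transitive closure of $\xrightarrow{\tau}$. $a_1\cdots a_k\in A^*$ is a weak trace of closed $s$ if $s\Rightarrow\xrightarrow{a_1}\Rightarrow\cdots\xrightarrow{a_k}\Rightarrow s'$; $\mathcal{WT}(s)$ the set. $s_1\precsim_{\rm WT}s_2$ iff $\mathcal{WT}(s_1)\subseteq\mathcal{WT}(s_2)$; on open terms via all closed substitutions. Inequational logic (reflexivity, transitivity, substitution instances, closure under contexts; an equation abbreviates two inequations); sound, ground-complete, $\omega$-complete (if all closed instances derivable then the inequation is). Axioms ($\alpha\in A_\tau$): A1: $x+y\approx y+x$; A2: $(x+y)+z\approx x+(y+z)$; A3: $x+x\approx x$; A4: $x+0\approx x$; T1$'$: $\alpha(x+y)\preccurlyeq\alpha x+\alpha y$; T2: $x\preccurlyeq x+y$; WE: $x\approx\tau x$. -}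

module Defs where

open import Data.Nat using (ℕ)
open import Data.List using (List; []; _∷_)
open import Data.Product using (_×_; Σ; _,_)
open import Relation.Binary.PropositionalEquality using (_≡_)
open import Relation.Nullary using (¬_)
open import Function.Definitions using (Injective)

module BCCS (A : Set) where

  data Act : Set where
    τ   : Act
    act : A → Act

  infixr 7 _·_
  infixl 6 _⊕_

  data Term : Set where
    𝟘   : Term
    var : ℕ → Term
    _·_ : Act → Term → Term
    _⊕_ : Term → Term → Term

  data Closed : Term → Set where
    c𝟘 : Closed 𝟘
    c· : ∀ {α t} → Closed t → Closed (α · t)
    c⊕ : ∀ {t u} → Closed t → Closed u → Closed (t ⊕ u)

  Subst : Set
  Subst = ℕ → Term

  ClosedSubst : Subst → Set
  ClosedSubst σ = ∀ n → Closed (σ n)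

  _[_] : Term → Subst → Term
  𝟘 [ σ ] = 𝟘
  var x [ σ ] = σ x
  (α · t) [ σ ] = α · (t [ σ ])
  (t ⊕ u) [ σ ] = (t [ σ ]) ⊕ (u [ σ ])

  data _—_⟶_ : Term → Act → Term → Set where
    pre  : ∀ {α t} → (α · t) — α ⟶ t
    sumˡ : ∀ {t u α t'} → t — α ⟶ t' → (t ⊕ u) — α ⟶ t'
    sumʳ : ∀ {t u α t'} → t — α ⟶ t' → (u ⊕ t) — α ⟶ t'

  data WT : Term → List A → Set where
    wt-nil : ∀ {s} → WT s []
    wt-τ   : ∀ {s s' w} → s — τ ⟶ s' → WT s' w → WT s w
    wt-a   : ∀ {s s' a w} → s — act a ⟶ s' → WT s' w → WT s (a ∷ w)

  _≲WTᶜ_ : Term → Term → Set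
  s ≲WTᶜ t = ∀ w → WT s w → WT t w

  _≲WT_ : Term → Term → Set
  t ≲WT u = ∀ σ → ClosedSubst σ → (t [ σ ]) ≲WTᶜ (u [ σ ])

  x y z : Term
  x = var 0
  y = var 1
  z = var 2

  -- The axioms A1-4, T1', T2, WE as inequations l ≼ r
  -- (an equation contributes both directions).
  data Axiom : Term → Term → Set where
    A1   : Axiom (x ⊕ y) (y ⊕ x)
    A2   : Axiom ((x ⊕ y) ⊕ z) (x ⊕ (y ⊕ z))
    A2'  : Axiom (x ⊕ (y ⊕ z)) ((x ⊕ y) ⊕ z)
    A3   : Axiom (x ⊕ x) x
    A3'  : Axiom x (x ⊕ x)
    A4   : Axiom (x ⊕ 𝟘) x
    A4'  : Axiom x (x ⊕ 𝟘)
    T1'  : ∀ α → Axiom (α · (x ⊕ y)) ((α · x) ⊕ (α · y))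
    T2   : Axiom x (x ⊕ y)
    WE   : Axiom x (τ · x)
    WE'  : Axiom (τ · x) x

  infix 4 ⊢_≼_
  data ⊢_≼_ : Term → Term → Set where
    ax    : ∀ {t u} → Axiom t u → ⊢ t ≼ u
    refl≼ : ∀ {t} → ⊢ t ≼ t
    trans≼ : ∀ {t u v} → ⊢ t ≼ u → ⊢ u ≼ v → ⊢ t ≼ v
    sub   : ∀ {t u} (σ : Subst) → ⊢ t ≼ u → ⊢ (t [ σ ]) ≼ (u [ σ ])
    ctx·  : ∀ {t u} (α : Act) → ⊢ t ≼ u → ⊢ (α · t) ≼ (α · u)
    ctx⊕  : ∀ {t t' u u'} → ⊢ t ≼ t' → ⊢ u ≼ u' → ⊢ (t ⊕ u) ≼ (t' ⊕ u')

  Sound : Set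
  Sound = ∀ t u → ⊢ t ≼ u → t ≲WT u

  GroundComplete : Set
  GroundComplete = ∀ t u → Closed t → Closed u → t ≲WT u → ⊢ t ≼ u

  OmegaComplete : Set
  OmegaComplete = ∀ t u → (∀ σ → ClosedSubst σ → ⊢ (t [ σ ]) ≼ (u [ σ ])) → ⊢ t ≼ u

NonemptyCountable : Set → Set
NonemptyCountable A = A × Σ (A → ℕ) (λ f → Injective _≡_ _≡_ f)

AtLeastTwo : Set → Set
AtLeastTwo A = Σ A (λ a → Σ A (λ b → ¬ (a ≡ b)))

-- Weak-trace inclusion is a preorder in which _⊕_ is a least
-- upper bound, 𝟘 is least, prefixing is monotone and distributes over _⊕_,
-- and τ-prefixing is invisible.
--
-- Writing  lin w t  for  a₁ · … · aₖ · t  (w = a₁ … aₖ), we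
-- show  ⊢ lin w t ≼ u  whenever, in every closed instance, w followed by any
-- weak trace of t is a weak trace of u (prefix-complete), by induction on t.
-- The base cases rest on "path-below": if u reaches s' along the weak
-- trace w then  ⊢ lin w s' ≼ u.  For t = 𝟘 we instantiate all variables by
-- 𝟘.  For t = var n (needed only in the open case, given actions a ≠ b) we
-- substitute  b · aᵏ · 𝟘  for n, with k the depth of u: a trace of u longer
-- than its depth must pass through a variable summand, and the position of
-- the last b pins that summand down to var n, reached along w exactly.
-- Ground and ω-completeness are the instances w = [] of prefix-complete.
module Submission where

open import Defs
open import Data.Product using (_×_; Σ; _,_)
open import Data.Sum using (_⊎_; inj₁; inj₂)
open import Data.Empty using (⊥; ⊥-elim)
open import Data.Nat using (ℕ; zero; suc; _≤_; _⊔_; z≤n; s≤s)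
open import Data.Nat.Properties
  using (≤-trans; ≤-refl; ≤-reflexive; n≤1+n; m≤m⊔n; m≤n⊔m; n≮n; _≟_)
open import Data.List using (List; []; _∷_; _++_; length; replicate)
open import Data.List.Properties
  using ( ++-identityʳ; ++-assoc; length-++-≤ʳ; length-replicate
        ; ∷-injective; ∷-injectiveˡ; ∷-injectiveʳ )
open import Relation.Binary.PropositionalEquality
  using (_≡_; refl; sym; trans; cong; cong₂; subst; subst₂)
open import Relation.Nullary using (¬_; yes; no)

module WeakTraceAxiomatisation (A : Set) where
  open BCCS A

  [-]-comp : ∀ t σ ρ → ((t [ σ ]) [ ρ ]) ≡ (t [ (λ n → σ n [ ρ ]) ])
  [-]-comp 𝟘 σ ρ = refl
  [-]-comp (var n) σ ρ = refl
  [-]-comp (α · t) σ ρ = cong (α ·_) ([-]-comp t σ ρ)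
  [-]-comp (t ⊕ u) σ ρ = cong₂ _⊕_ ([-]-comp t σ ρ) ([-]-comp u σ ρ)

  [-]-id : ∀ t → (t [ var ]) ≡ t
  [-]-id 𝟘 = refl
  [-]-id (var n) = refl
  [-]-id (α · t) = cong (α ·_) ([-]-id t)
  [-]-id (t ⊕ u) = cong₂ _⊕_ ([-]-id t) ([-]-id u)

  -- Weak-trace inclusion between arbitrary terms (variables have no steps).
  infix 4 _≲_
  _≲_ : Term → Term → Set
  _≲_ = _≲WTᶜ_

  ≲-refl : ∀ {p} → p ≲ p
  ≲-refl w h = h

  ≲-trans : ∀ {p q r} → p ≲ q → q ≲ r → p ≲ r
  ≲-trans p≲q q≲r w h = q≲r w (p≲q w h)

  ⊕-traces : ∀ {p q w} → WT (p ⊕ q) w → WT p w ⊎ WT q w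
  ⊕-traces wt-nil = inj₁ wt-nil
  ⊕-traces (wt-τ (sumˡ st) r) = inj₁ (wt-τ st r)
  ⊕-traces (wt-τ (sumʳ st) r) = inj₂ (wt-τ st r)
  ⊕-traces (wt-a (sumˡ st) r) = inj₁ (wt-a st r)
  ⊕-traces (wt-a (sumʳ st) r) = inj₂ (wt-a st r)

  ⊕-upperˡ : ∀ {p q} → p ≲ p ⊕ q
  ⊕-upperˡ _ wt-nil = wt-nil
  ⊕-upperˡ _ (wt-τ st r) = wt-τ (sumˡ st) r
  ⊕-upperˡ _ (wt-a st r) = wt-a (sumˡ st) r

  ⊕-upperʳ : ∀ {p q} → q ≲ p ⊕ q
  ⊕-upperʳ _ wt-nil = wt-nil
  ⊕-upperʳ _ (wt-τ st r) = wt-τ (sumʳ st) r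
  ⊕-upperʳ _ (wt-a st r) = wt-a (sumʳ st) r

  ⊕-least : ∀ {p q r} → p ≲ r → q ≲ r → p ⊕ q ≲ r
  ⊕-least p≲r q≲r w h with ⊕-traces h
  ... | inj₁ hp = p≲r w hp
  ... | inj₂ hq = q≲r w hq

  ⊕-mono : ∀ {p p' q q'} → p ≲ p' → q ≲ q' → p ⊕ q ≲ p' ⊕ q'
  ⊕-mono p≲p' q≲q' = ⊕-least (≲-trans p≲p' ⊕-upperˡ) (≲-trans q≲q' ⊕-upperʳ)

  𝟘-traces : ∀ {w} → WT 𝟘 w → w ≡ []
  𝟘-traces wt-nil = refl
  𝟘-traces (wt-τ () _)
  𝟘-traces (wt-a () _)

  𝟘-least : ∀ {p} → 𝟘 ≲ p
  𝟘-least w h with 𝟘-traces h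
  ... | refl = wt-nil

  ·-mono : ∀ α {p q} → p ≲ q → α · p ≲ α · q
  ·-mono α p≲q _ wt-nil = wt-nil
  ·-mono α p≲q w (wt-τ pre r) = wt-τ pre (p≲q w r)
  ·-mono α p≲q (_ ∷ w) (wt-a pre r) = wt-a pre (p≲q w r)

  ·-⊕-traces : ∀ {α p q w} → WT (α · (p ⊕ q)) w → WT (α · p) w ⊎ WT (α · q) w
  ·-⊕-traces wt-nil = inj₁ wt-nil
  ·-⊕-traces (wt-τ pre r) with ⊕-traces r
  ... | inj₁ rp = inj₁ (wt-τ pre rp)
  ... | inj₂ rq = inj₂ (wt-τ pre rq)
  ·-⊕-traces (wt-a pre r) with ⊕-traces r
  ... | inj₁ rp = inj₁ (wt-a pre rp)
  ... | inj₂ rq = inj₂ (wt-a pre rq)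

  ·-distrib : ∀ α {p q} → α · (p ⊕ q) ≲ (α · p) ⊕ (α · q)
  ·-distrib α w h with ·-⊕-traces h
  ... | inj₁ hp = ⊕-upperˡ w hp
  ... | inj₂ hq = ⊕-upperʳ w hq

  τ-intro : ∀ {p} → p ≲ τ · p
  τ-intro w h = wt-τ pre h

  τ-elim : ∀ {p} → τ · p ≲ p
  τ-elim _ wt-nil = wt-nil
  τ-elim w (wt-τ pre r) = r

  axiom-sound : ∀ {l r} → Axiom l r → ∀ σ → l [ σ ] ≲ r [ σ ]
  axiom-sound A1 σ = ⊕-least ⊕-upperʳ ⊕-upperˡ
  axiom-sound A2 σ =
    ⊕-least (⊕-least ⊕-upperˡ (≲-trans ⊕-upperˡ ⊕-upperʳ)) (≲-trans ⊕-upperʳ ⊕-upperʳ)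
  axiom-sound A2' σ =
    ⊕-least (≲-trans ⊕-upperˡ ⊕-upperˡ) (⊕-least (≲-trans ⊕-upperʳ ⊕-upperˡ) ⊕-upperʳ)
  axiom-sound A3 σ = ⊕-least ≲-refl ≲-refl
  axiom-sound A3' σ = ⊕-upperˡ
  axiom-sound A4 σ = ⊕-least ≲-refl 𝟘-least
  axiom-sound A4' σ = ⊕-upperˡ
  axiom-sound (T1' α) σ = ·-distrib α
  axiom-sound T2 σ = ⊕-upperˡ
  axiom-sound WE σ = τ-intro
  axiom-sound WE' σ = τ-elim

  derivable-sound : ∀ {t u} → ⊢ t ≼ u → ∀ σ → t [ σ ] ≲ u [ σ ]
  derivable-sound (ax a) σ = axiom-sound a σ
  derivable-sound refl≼ σ = ≲-refl
  derivable-sound (trans≼ d e) σ = ≲-trans (derivable-sound d σ) (derivable-sound e σ)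
  derivable-sound (sub {t} {u} ρ d) σ =
    subst₂ _≲_ (sym ([-]-comp t ρ σ)) (sym ([-]-comp u ρ σ)) (derivable-sound d _)
  derivable-sound (ctx· α d) σ = ·-mono α (derivable-sound d σ)
  derivable-sound (ctx⊕ d e) σ = ⊕-mono (derivable-sound d σ) (derivable-sound e σ)

  derivable⇒≲ : ∀ {p q} → ⊢ p ≼ q → p ≲ q
  derivable⇒≲ {p} {q} d = subst₂ _≲_ ([-]-id p) ([-]-id q) (derivable-sound d var)

  sound : Sound
  sound t u d σ _ = derivable-sound d σ

  inst₂ : Term → Term → Subst
  inst₂ p q zero = p
  inst₂ p q (suc _) = q

  ≼-upperˡ : ∀ p q → ⊢ p ≼ p ⊕ q
  ≼-upperˡ p q = sub (inst₂ p q) (ax T2)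

  ≼-upperʳ : ∀ p q → ⊢ q ≼ p ⊕ q
  ≼-upperʳ p q = trans≼ (≼-upperˡ q p) (sub (inst₂ q p) (ax A1))

  ≼-least : ∀ {p q r} → ⊢ p ≼ r → ⊢ q ≼ r → ⊢ p ⊕ q ≼ r
  ≼-least {r = r} p≼r q≼r = trans≼ (ctx⊕ p≼r q≼r) (sub (inst₂ r r) (ax A3))

  ≼-𝟘-least : ∀ p → ⊢ 𝟘 ≼ p
  ≼-𝟘-least p = trans≼ (≼-upperʳ p 𝟘) (sub (inst₂ p p) (ax A4))

  ≼-τ-intro : ∀ p → ⊢ p ≼ τ · p
  ≼-τ-intro p = sub (inst₂ p p) (ax WE)

  ≼-τ-elim : ∀ p → ⊢ τ · p ≼ p
  ≼-τ-elim p = sub (inst₂ p p) (ax WE')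

  ≼-distrib : ∀ α p q → ⊢ α · (p ⊕ q) ≼ (α · p) ⊕ (α · q)
  ≼-distrib α p q = sub (inst₂ p q) (ax (T1' α))

  lin : List A → Term → Term
  lin [] t = t
  lin (a ∷ w) t = act a · lin w t

  lin-++ : ∀ w v t → lin (w ++ v) t ≡ lin w (lin v t)
  lin-++ [] v t = refl
  lin-++ (a ∷ w) v t = cong (act a ·_) (lin-++ w v t)

  lin-mono : ∀ w {p q} → ⊢ p ≼ q → ⊢ lin w p ≼ lin w q
  lin-mono [] d = d
  lin-mono (a ∷ w) d = ctx· (act a) (lin-mono w d)

  lin-distrib : ∀ w p q → ⊢ lin w (p ⊕ q) ≼ lin w p ⊕ lin w q
  lin-distrib [] p q = refl≼
  lin-distrib (a ∷ w) p q =
    trans≼ (ctx· (act a) (lin-distrib w p q)) (≼-distrib (act a) (lin w p) (lin w q))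

  lin-closed : ∀ w {t} → Closed t → Closed (lin w t)
  lin-closed [] c = c
  lin-closed (a ∷ w) c = c· (lin-closed w c)

  lin-trace : ∀ w → WT (lin w 𝟘) w
  lin-trace [] = wt-nil
  lin-trace (a ∷ w) = wt-a pre (lin-trace w)

  data _⇒[_]_ : Term → List A → Term → Set where
    done  : ∀ {s} → s ⇒[ [] ] s
    τstep : ∀ {s s' s'' w} → s — τ ⟶ s' → s' ⇒[ w ] s'' → s ⇒[ w ] s''
    astep : ∀ {s s' s'' a w} → s — act a ⟶ s' → s' ⇒[ w ] s'' → s ⇒[ a ∷ w ] s''

  trace-path : ∀ {s w} → WT s w → Σ Term λ s' → s ⇒[ w ] s'
  trace-path wt-nil = _ , done
  trace-path (wt-τ st r) with trace-path r
  ... | s' , p = s' , τstep st p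
  trace-path (wt-a st r) with trace-path r
  ... | s' , p = s' , astep st p

  data VarSummand : Term → ℕ → Set where
    here : ∀ {n} → VarSummand (var n) n
    inˡ  : ∀ {t u n} → VarSummand t n → VarSummand (t ⊕ u) n
    inʳ  : ∀ {t u n} → VarSummand t n → VarSummand (u ⊕ t) n

  step-below : ∀ {s α s'} → s — α ⟶ s' → ⊢ α · s' ≼ s
  step-below pre = refl≼
  step-below (sumˡ {t} {u} st) = trans≼ (step-below st) (≼-upperˡ t u)
  step-below (sumʳ {t} {u} st) = trans≼ (step-below st) (≼-upperʳ u t)

  summand-below : ∀ {s n} → VarSummand s n → ⊢ var n ≼ s
  summand-below here = refl≼
  summand-below (inˡ {t} {u} vs) = trans≼ (summand-below vs) (≼-upperˡ t u)
  summand-below (inʳ {t} {u} vs) = trans≼ (summand-below vs) (≼-upperʳ u t)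

  -- The key fact behind completeness: a derivative prefixed by the weak
  -- trace leading to it lies below the term (τ-steps are absorbed by WE).
  path-below : ∀ {s w s'} → s ⇒[ w ] s' → ⊢ lin w s' ≼ s
  path-below done = refl≼
  path-below (τstep {s' = s'} st p) =
    trans≼ (path-below p) (trans≼ (≼-τ-intro s') (step-below st))
  path-below (astep {a = a} st p) = trans≼ (ctx· (act a) (path-below p)) (step-below st)

  trace-below : ∀ {s w} → WT s w → ⊢ lin w 𝟘 ≼ s
  trace-below {w = w} h with trace-path h
  ... | s' , p = trans≼ (lin-mono w (≼-𝟘-least s')) (path-below p)

  data StepOfInstance (σ : Subst) (u : Term) (α : Act) : Term → Set where
    term-step : ∀ {u'} → u — α ⟶ u' → StepOfInstance σ u α (u' [ σ ])
    var-step  : ∀ {m r} → VarSummand u m → σ m — α ⟶ r → StepOfInstance σ u α r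

  step-of-instance : ∀ σ u {α r} → (u [ σ ]) — α ⟶ r → StepOfInstance σ u α r
  step-of-instance σ 𝟘 ()
  step-of-instance σ (var m) st = var-step here st
  step-of-instance σ (α · t) pre = term-step pre
  step-of-instance σ (t ⊕ t') (sumˡ st) with step-of-instance σ t st
  ... | term-step st' = term-step (sumˡ st')
  ... | var-step vs st' = var-step (inˡ vs) st'
  step-of-instance σ (t ⊕ t') (sumʳ st) with step-of-instance σ t' st
  ... | term-step st' = term-step (sumʳ st')
  ... | var-step vs st' = var-step (inʳ vs) st'

  data Decomposition (σ : Subst) (u : Term) (z : List A) : Set where
    inner   : ∀ {s'} → u ⇒[ z ] s' → Decomposition σ u z
    through : ∀ {w₁ v m s'} → z ≡ w₁ ++ v → u ⇒[ w₁ ] s' → VarSummand s' m →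
              WT (σ m) v → Decomposition σ u z

  decompose : ∀ σ u {z} → WT (u [ σ ]) z → Decomposition σ u z
  decompose σ u wt-nil = inner done
  decompose σ u (wt-τ st r) with step-of-instance σ u st
  ... | var-step vs st' = through refl done vs (wt-τ st' r)
  ... | term-step {u'} st' with decompose σ u' r
  ...   | inner p = inner (τstep st' p)
  ...   | through eq p vs tr = through eq (τstep st' p) vs tr
  decompose σ u (wt-a st r) with step-of-instance σ u st
  ... | var-step vs st' = through refl done vs (wt-a st' r)
  ... | term-step {u'} st' with decompose σ u' r
  ...   | inner p = inner (astep st' p)
  ...   | through eq p vs tr = through (cong (_ ∷_) eq) (astep st' p) vs tr

  depth : Term → ℕ
  depth 𝟘 = 0
  depth (var _) = 0
  depth (α · t) = suc (depth t)
  depth (t ⊕ u) = depth t ⊔ depth u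

  step-depth : ∀ {s α s'} → s — α ⟶ s' → suc (depth s') ≤ depth s
  step-depth pre = ≤-refl
  step-depth (sumˡ {t} {u} st) = ≤-trans (step-depth st) (m≤m⊔n (depth t) (depth u))
  step-depth (sumʳ {t} {u} st) = ≤-trans (step-depth st) (m≤n⊔m (depth u) (depth t))

  path-length : ∀ {s w s'} → s ⇒[ w ] s' → length w ≤ depth s
  path-length done = z≤n
  path-length (τstep {s' = s'} st p) =
    ≤-trans (path-length p) (≤-trans (n≤1+n (depth s')) (step-depth st))
  path-length (astep st p) = ≤-trans (s≤s (path-length p)) (step-depth st)

  point : ℕ → Term → Subst
  point n t m with m ≟ n
  ... | yes _ = t
  ... | no _ = 𝟘

  point-closed : ∀ n {t} → Closed t → ClosedSubst (point n t)
  point-closed n c m with m ≟ n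
  ... | yes _ = c
  ... | no _ = c𝟘

  point-at : ∀ n t → point n t n ≡ t
  point-at n t with n ≟ n
  ... | yes _ = refl
  ... | no n≢n = ⊥-elim (n≢n refl)

  point-traces : ∀ n t {m v} → WT (point n t m) v → (m ≡ n × WT t v) ⊎ v ≡ []
  point-traces n t {m} h with m ≟ n
  ... | yes m≡n = inj₁ (m≡n , h)
  ... | no _ = inj₂ (𝟘-traces h)

  -- In every closed instance, w followed by any weak trace of t is a weak
  -- trace of u; this is what  ⊢ lin w t ≼ u  asserts semantically.
  TracesAfter : List A → Term → Term → Set
  TracesAfter w t u =
    ∀ σ → ClosedSubst σ → ∀ v → WT (t [ σ ]) v → WT (u [ σ ]) (w ++ v)

  module Separation (a b : A) (a≢b : ¬ (a ≡ b)) where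

    probe : ℕ → List A
    probe k = b ∷ replicate k a

    probe-length : ∀ k → length (probe k) ≡ suc k
    probe-length k = cong suc (length-replicate k)

    replicate-traces : ∀ k {v} → WT (lin (replicate k a) 𝟘) v → Σ ℕ λ j → v ≡ replicate j a
    replicate-traces zero h = 0 , 𝟘-traces h
    replicate-traces (suc k) wt-nil = 0 , refl
    replicate-traces (suc k) (wt-a pre r) with replicate-traces k r
    ... | j , refl = suc j , refl

    probe-traces : ∀ k {v} → WT (lin (probe k) 𝟘) v →
                   v ≡ [] ⊎ Σ ℕ λ j → v ≡ b ∷ replicate j a
    probe-traces k wt-nil = inj₁ refl
    probe-traces k (wt-a pre r) with replicate-traces k r
    ... | j , refl = inj₂ (j , refl)

    b∉aᵏ : ∀ k xs {ys} → ¬ (replicate k a ≡ xs ++ b ∷ ys)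
    b∉aᵏ zero [] ()
    b∉aᵏ zero (_ ∷ _) ()
    b∉aᵏ (suc k) [] eq = a≢b (∷-injectiveˡ eq)
    b∉aᵏ (suc k) (_ ∷ xs) eq = b∉aᵏ k xs (∷-injectiveʳ eq)

    last-b : ∀ w w₁ k j → w ++ b ∷ replicate k a ≡ w₁ ++ b ∷ replicate j a → w ≡ w₁
    last-b [] [] k j eq = refl
    last-b [] (_ ∷ w₁) k j eq = ⊥-elim (b∉aᵏ k w₁ (∷-injectiveʳ eq))
    last-b (_ ∷ w) [] k j eq = ⊥-elim (b∉aᵏ j w (sym (∷-injectiveʳ eq)))
    last-b (c ∷ w) (d ∷ w₁) k j eq with ∷-injective eq
    ... | c≡d , eq' = cong₂ _∷_ c≡d (last-b w w₁ k j eq')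

    -- Substituting the probe b · aᵏ · 𝟘 (k = depth u) for var n forces the
    -- trace w ++ b aᵏ of u to pass through the summand var n after exactly w.
    var-complete : ∀ u n w → TracesAfter w (var n) u → ⊢ lin w (var n) ≼ u
    var-complete u n w h = resolve (decompose σ u probed)
      where
      k : ℕ
      k = depth u

      σ : Subst
      σ = point n (lin (probe k) 𝟘)

      probed : WT (u [ σ ]) (w ++ probe k)
      probed = h σ (point-closed n (lin-closed (probe k) c𝟘)) (probe k)
        (subst (λ t → WT t (probe k)) (sym (point-at n _)) (lin-trace (probe k)))

      too-long : ∀ {w₁ s'} → w ++ probe k ≡ w₁ → u ⇒[ w₁ ] s' → ⊥
      too-long refl p = n≮n k (≤-trans long (path-length p))
        where
        long : suc k ≤ length (w ++ probe k)
        long = ≤-trans (≤-reflexive (sym (probe-length k))) (length-++-≤ʳ (probe k) {w})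

      resolve : Decomposition σ u (w ++ probe k) → ⊢ lin w (var n) ≼ u
      resolve (inner p) = ⊥-elim (too-long refl p)
      resolve (through {w₁} {m = m} eq p vs tr) with point-traces n _ {m} tr
      ... | inj₂ refl = ⊥-elim (too-long (trans eq (++-identityʳ w₁)) p)
      ... | inj₁ (refl , tr') with probe-traces k tr'
      ...   | inj₁ refl = ⊥-elim (too-long (trans eq (++-identityʳ w₁)) p)
      ...   | inj₂ (j , refl) with last-b w w₁ k j eq
      ...     | refl = trans≼ (lin-mono w (summand-below vs)) (path-below p)

  collapse : Subst
  collapse _ = 𝟘

  collapse-below : ∀ u → ⊢ u [ collapse ] ≼ u
  collapse-below 𝟘 = refl≼
  collapse-below (var n) = ≼-𝟘-least (var n)
  collapse-below (α · u) = ctx· α (collapse-below u)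
  collapse-below (u ⊕ u') = ctx⊕ (collapse-below u) (collapse-below u')

  zero-complete : ∀ u w → TracesAfter w 𝟘 u → ⊢ lin w 𝟘 ≼ u
  zero-complete u w h = trans≼ (trace-below w-trace) (collapse-below u)
    where
    w-trace : WT (u [ collapse ]) w
    w-trace = subst (WT (u [ collapse ])) (++-identityʳ w) (h collapse (λ _ → c𝟘) [] wt-nil)

  -- Variables of t can be handled: t is closed, or A has two distinct actions.
  Separable : Term → Set
  Separable t = Closed t ⊎ AtLeastTwo A

  separable-· : ∀ {α t} → Separable (α · t) → Separable t
  separable-· (inj₁ (c· c)) = inj₁ c
  separable-· (inj₂ two) = inj₂ two

  separable-⊕ˡ : ∀ {t t'} → Separable (t ⊕ t') → Separable t
  separable-⊕ˡ (inj₁ (c⊕ c _)) = inj₁ c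
  separable-⊕ˡ (inj₂ two) = inj₂ two

  separable-⊕ʳ : ∀ {t t'} → Separable (t ⊕ t') → Separable t'
  separable-⊕ʳ (inj₁ (c⊕ _ c)) = inj₁ c
  separable-⊕ʳ (inj₂ two) = inj₂ two

  -- Completeness with an accumulated prefix, by induction on t: prefixes
  -- move into w, sums split by T1' and A3, τ is removed by WE.
  prefix-complete : ∀ t u w → Separable t → TracesAfter w t u → ⊢ lin w t ≼ u
  prefix-complete 𝟘 u w _ h = zero-complete u w h
  prefix-complete (var n) u w (inj₁ ())
  prefix-complete (var n) u w (inj₂ (a , b , a≢b)) h = Separation.var-complete a b a≢b u n w h
  prefix-complete (τ · t) u w sep h =
    trans≼ (lin-mono w (≼-τ-elim t))
      (prefix-complete t u w (separable-· sep) (λ σ cσ v r → h σ cσ v (wt-τ pre r)))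
  prefix-complete (act a · t) u w sep h =
    subst (λ l → ⊢ l ≼ u) (lin-++ w (a ∷ []) t)
      (prefix-complete t u (w ++ a ∷ []) (separable-· sep) h')
    where
    h' : TracesAfter (w ++ a ∷ []) t u
    h' σ cσ v r = subst (WT (u [ σ ])) (sym (++-assoc w (a ∷ []) v)) (h σ cσ (a ∷ v) (wt-a pre r))
  prefix-complete (t ⊕ t') u w sep h =
    trans≼ (lin-distrib w t t')
      (≼-least (prefix-complete t u w (separable-⊕ˡ sep) (λ σ cσ v r → h σ cσ v (⊕-upperˡ v r)))
               (prefix-complete t' u w (separable-⊕ʳ sep) (λ σ cσ v r → h σ cσ v (⊕-upperʳ v r))))

  ground-complete : GroundComplete
  ground-complete t u ct _ t≲u = prefix-complete t u [] (inj₁ ct) t≲u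

  -- If all closed instances are derivable, soundness turns them into trace
  -- inclusions, which is the hypothesis of prefix-complete for w = [].
  omega-complete : AtLeastTwo A → OmegaComplete
  omega-complete two t u h =
    prefix-complete t u [] (inj₂ two) (λ σ cσ → derivable⇒≲ (h σ cσ))

theorem4p6 : (A : Set) → NonemptyCountable A →
    BCCS.Sound A × BCCS.GroundComplete A × (AtLeastTwo A → BCCS.OmegaComplete A)
theorem4p6 A _ =
  sound , ground-complete , omega-complete
  where open WeakTraceAxiomatisation A
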